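{- Let $(G,S,T,g,k)$ be an instance of Planar Disjoint Paths and let $R$ be a Steiner tree. Let $\{\mathrm{pairing}_v\}_{v\in V^\star(R)}$ be a non-crossing pairing. Then $\left|\bigcup_{v\in V^\star(R)}\mathrm{pairing}_v\right|\leq 48k$.
   Context: Instance $(G,S,T,g,k)$: $G$ plane, $S,T\subseteq V(G)$, $k=|S|$, $g:S\to T$ bijective. $H$ is the radial completion of $G$ (a vertex in each face adjacent to all boundary vertices, plus the edges of $G$), embedded in the plane. A Steiner tree is a subtree $R$ of $H$ whose leaf set is exactly $S\cup T$. $V_{=1}(R)$, $V_{=2}(R)$, $V_{\ge3}(R)$ denote vertices of $R$ of degree $1$, $2$, at least $3$ in $R$; $V^\star_2(R)$ is the set of $v\in V_{=2}(R)$ adjacent in $R$ to a vertex of $V_{=1}(R)\cup V_{\ge3}(R)$; $V^\star(R)=V_{=1}(R)\cup V_{\ge3}(R)\cup V^\star_2(R)$. A pairing at $v\in V_{\ge3}(R)$ is a set of unordered pairs of distinct edges of $R$ incident to $v$; at $v\in V^\star_2(R)$ it is a set of pairs of (possibly equal) edges of $R$ incident to $v$; at $v\in V_{=1}(R)$ it is either empty or the singleton containing the pair formed by the unique edge of $R$ at $v$ taken twice. A pairing is a collection $\{\mathrm{pairing}_v\}_{v\in V^\star(R)}$ with $\mathrm{pairing}_v$ a pairing at $v$. A pairing at $v$ is non-crossing if, letting $e^1,\dots,e^r$ be the edges of $R$ at $v$ in clockwise order (starting arbitrarily), there are no two pairs $(e^i,e^j),(e^x,e^y)$ in it with $i<j$,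 $x<y$ and $i<x<j<y$ or $x<i<y<j$; the collection is non-crossing if every $\mathrm{pairing}_v$ is. -}

module Defs where

open import Data.Nat using (ℕ; zero; suc; _+_; _*_; _≤_; _<_; _≤ᵇ_)
open import Data.Fin using (Fin; toℕ; _≟_)
open import Data.Bool using (Bool; true; false; _∧_; if_then_else_)
open import Data.List using (List; length; allFin; cartesianProduct)
open import Data.Bool.ListAction using (any)
open import Data.List.Base using (filterᵇ)
open import Data.Product using (Σ; ∃; ∃-syntax; _×_; _,_; proj₁; proj₂)
open import Data.Sum using (_⊎_)
open import Data.Empty using (⊥)
open import Relation.Nullary using (¬_; does)
open import Relation.Binary.PropositionalEquality using (_≡_; _≢_)
open import Function.Bundles using (_⇔_)

iter : {A : Set} → (A → A) → ℕ → A → A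
iter f zero    x = x
iter f (suc n) x = f (iter f n x)

_==_ : {n : ℕ} → Fin n → Fin n → Bool
x == y = does (x ≟ y)

-- Embedded simple graphs as combinatorial maps (rotation systems).
-- Vertices Fin N, darts (directed half-edges) Fin D.
-- tail d : the vertex at which dart d starts;
-- α : the involution pairing the two darts of an edge;
-- σ : the clockwise rotation of darts around their tail vertex.
record Map : Set where
  field
    N D     : ℕ
    tail    : Fin D → Fin N
    α       : Fin D → Fin D
    σ       : Fin D → Fin D
    σ⁻¹     : Fin D → Fin D
    α-invol : ∀ d → α (α d) ≡ d
    α-nofix : ∀ d → α d ≢ d
    σ-left  : ∀ d → σ⁻¹ (σ d) ≡ d
    σ-right : ∀ d → σ (σ⁻¹ d) ≡ d
    σ-vertex : ∀ d d' → (tail d ≡ tail d') ⇔ (∃[ i ] iter σ i d ≡ d')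
    no-loop     : ∀ d → tail (α d) ≢ tail d
    no-parallel : ∀ d d' → tail d ≡ tail d' → tail (α d) ≡ tail (α d') → d ≡ d'

module _ (M : Map) where
  open Map M

  head : Fin D → Fin N
  head d = tail (α d)

  -- face tracing permutation
  φ : Fin D → Fin D
  φ d = σ (α d)

  Adj : Fin N → Fin N → Set
  Adj x y = ∃[ d ] (tail d ≡ x × head d ≡ y)

  data Reach (ok : Fin D → Bool) : Fin N → Fin N → Set where
    here : ∀ {v} → Reach ok v v
    step : ∀ {v} d → ok d ≡ true → Reach ok (head d) v → Reach ok (tail d) v

  degOf : (Fin D → Bool) → Fin N → ℕ
  degOf ok v = length (filterᵇ (λ d → ok d ∧ (tail d == v)) (allFin D))

  degM : Fin N → ℕ
  degM = degOf (λ _ → true)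

  -- The map is a plane embedding: connected, and of Euler genus 0
  -- (faces = orbits of φ, labelled by face : Fin D → Fin F).
  record IsPlane : Set where
    field
      connected  : ∀ u v → Reach (λ _ → true) u v
      F          : ℕ
      face       : Fin D → Fin F
      face-surj  : ∀ f → ∃[ d ] face d ≡ f
      face-orbit : ∀ d d' → (face d ≡ face d') ⇔ (∃[ i ] iter φ i d ≡ d')
      -- V - E + F = 2  (with E = D/2), or the graph has no edge
      euler      : D ≡ 0 ⊎ 2 * (N + F) ≡ D + 4

-- H is a plane map, ι embeds V(G)
-- into V(H); the remaining vertices of H are the face vertices Z.
-- H is the radial completion of the plane graph G (whose embedding is the
-- one induced from H): H[ι(V(G))] = G, Z is independent, every face of H
-- contains exactly one vertex z of Z, and every vertex of G on that face
-- is adjacent to z.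
module _ (H : Map) (Hp : IsPlane H) where
  open Map H
  open IsPlane Hp

  record IsRadialCompletion (n : ℕ) (adjG : Fin n → Fin n → Bool)
                            (ι : Fin n → Fin N) : Set where
    Zv : Fin N → Set
    Zv x = ¬ (∃[ u ] ι u ≡ x)
    field
      ι-inj   : ∀ u v → ι u ≡ ι v → u ≡ v
      G-edges : ∀ u v → (adjG u v ≡ true) ⇔ Adj H (ι u) (ι v)
      Z-indep : ∀ d → Zv (tail d) → Zv (head H d) → ⊥
      face-Z  : ∀ f → Σ (Fin N) λ z →
                  Zv z
                × (∃[ d ] (face d ≡ f × tail d ≡ z))
                × (∀ d → face d ≡ f → Zv (tail d) → tail d ≡ z)
                × (∀ d u → face d ≡ f → tail d ≡ ι u → Adj H z (ι u))

module _ (H : Map) where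
  open Map H

  count : {m : ℕ} → (Fin m → Bool) → ℕ
  count {m} p = length (filterᵇ p (allFin m))

  record IsSubtree (RV : Fin N → Bool) (RE : Fin D → Bool) : Set where
    field
      RE-α      : ∀ d → RE (α d) ≡ RE d
      RE-tail   : ∀ d → RE d ≡ true → RV (tail d) ≡ true
      nonempty  : ∃[ v ] RV v ≡ true
      connected : ∀ u v → RV u ≡ true → RV v ≡ true → Reach H RE u v
      -- connected with |E(R)| = |V(R)| - 1, i.e. acyclic  (#darts = 2|E|)
      tree      : 2 * count RV ≡ count RE + 2

  module _ (RV : Fin N → Bool) (RE : Fin D → Bool) where
    degR : Fin N → ℕ
    degR = degOf H RE

    V=1 V≥3 V=2 V★2 V★ : Fin N → Set
    V=1 v = RV v ≡ true × degR v ≡ 1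
    V≥3 v = RV v ≡ true × 3 ≤ degR v
    V=2 v = RV v ≡ true × degR v ≡ 2
    V★2 v = V=2 v × ∃[ d ] (RE d ≡ true × tail d ≡ v × (V=1 (head H d) ⊎ V≥3 (head H d)))
    V★  v = V=1 v ⊎ V≥3 v ⊎ V★2 v

    -- A pairing: pair v a b ≡ true means that the unordered pair of edges
    -- {edge of a, edge of b} belongs to pairing_v; edges of R incident to v
    -- are represented by the R-darts with tail v.
    record IsPairing (pair : Fin N → Fin D → Fin D → Bool) : Set where
      field
        sym     : ∀ v a b → pair v a b ≡ pair v b a
        support : ∀ v a b → pair v a b ≡ true →
                    V★ v × RE a ≡ true × RE b ≡ true × tail a ≡ v × tail b ≡ v
        at-V≥3  : ∀ v a b → V≥3 v → pair v a b ≡ true → a ≢ b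
        at-V=1  : ∀ v a b → V=1 v → pair v a b ≡ true → a ≡ b

    -- Non-crossing: listing the darts at v clockwise starting from any d₀,
    -- no two pairs {a,b}, {c,d} occupy positions i < x < j < y.
    -- (Positions are taken in the full rotation of H at v; restricted to
    -- the R-darts this is the clockwise order e¹,…,eʳ of the edges of R.)
    NonCrossing : (Fin N → Fin D → Fin D → Bool) → Set
    NonCrossing pair = ∀ v a b c d d₀ i x j y →
      pair v a b ≡ true → pair v c d ≡ true → tail d₀ ≡ v →
      i < x → x < j → j < y → y < degM H v →
      iter σ i d₀ ≡ a → iter σ x d₀ ≡ c → iter σ j d₀ ≡ b → iter σ y d₀ ≡ d → ⊥

    -- canonical dart representing the edge {d, α d}
    edgeRep : Fin D → Fin D
    edgeRep d = if toℕ d ≤ᵇ toℕ (α d) then d else α d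

    -- (x , y) with x,y edge representatives is in ⋃_v pairing_v
    inUnion : (Fin N → Fin D → Fin D → Bool) → Fin D → Fin D → Bool
    inUnion pair x y =
      any (λ v → any (λ a → any (λ b →
        pair v a b ∧ ((edgeRep a == x) ∧ (edgeRep b == y)))
        (allFin D)) (allFin D)) (allFin N)

    -- | ⋃_{v ∈ V*(R)} pairing_v |  (unordered pairs of edges, each counted once)
    unionSize : (Fin N → Fin D → Fin D → Bool) → ℕ
    unionSize pair = length (filterᵇ
      (λ p → (toℕ (proj₁ p) ≤ᵇ toℕ (proj₂ p)) ∧ inUnion pair (proj₁ p) (proj₂ p))
      (cartesianProduct (allFin D) (allFin D)))

module Submission where

-- Every element of the union comes from a pair {a, b} of R-darts at a common vertex v.
-- Measuring positions clockwise from a fixed origin dart at v orients it as a ≤ b, and the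
-- oriented pair is of one of three kinds: a loop a = b (only at leaves and at V★₂ vertices,
-- since pairs at V≥3 vertices are proper); a pair in which a is the first partner of b (at
-- most one per dart b); or a pair in which b has a partner c before a. In the last kind a
-- second such pair (a, b′) with b < b′ would cross (c, b), so there is at most one per dart
-- a, and v is a branch vertex, since a V★₂ vertex has only two darts. Writing L, S for the
-- numbers of leaves and V★₂ vertices and B for the total degree of the branch vertices, the
-- union therefore has at most L + 4S + 2B elements. In a tree B ≤ 3L − 6; each V★₂ vertex
-- is adjacent to a leaf or branch vertex, so S ≤ L + B; and L ≤ 2k. Hence 23L ≤ 46k bounds
-- the union.

open import Defs
open import Level using (0ℓ)
open import Data.Nat as ℕ using (ℕ; zero; suc; _+_; _*_; _∸_; _≤_; _<_; z≤n; s≤s; s≤s⁻¹)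
open import Data.Nat.Properties
  using (+-*-semiring; ≤-refl; ≤-trans; ≤-reflexive; ≤-antisym; <-≤-trans; <⇒≤; <⇒≢; ≰⇒>; ≤∧≢⇒<; <-cmp; <-irrefl;
         1+n≰n; _≤?_; _<?_; +-mono-≤; +-monoʳ-≤; +-cancelʳ-≤; *-monoʳ-≤; *-monoˡ-≤; m≤m+n; m≤n+m;
         m<n⇒0<n∸m; m+[n∸m]≡n; m∸n≤m; +-identityʳ; +-comm; +-assoc; *-identityˡ; *-identityʳ; *-zeroʳ; *-comm;
         *-assoc; *-distribˡ-+; module ≤-Reasoning)
open import Data.Nat.DivMod using (_%_; _/_; m%n<n; m≡m%n+[m/n]*n)
open import Data.Nat.Tactic.RingSolver using (solve-∀)
open import Algebra.Properties.Semiring.Sum +-*-semiring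
  using (sum-syntax; ∑-comm; ∑-distrib-+; sum-cong-≗; *-distribˡ-sum)
open import Data.Fin using (Fin; zero; suc; toℕ; _≟_; splitAt; _↑ˡ_; _↑ʳ_)
open import Data.Fin.Properties
  using (any?; suc-injective; 0≢1+n; toℕ-injective; toℕ<n; splitAt-↑ˡ; splitAt-↑ʳ)
  renaming (<-cmp to <-cmpᶠ; _<?_ to _<ᶠ?_)
open import Data.Bool using (Bool; true; false; _∧_; _∨_; T)
open import Data.Bool.ListAction using (any)
open import Data.Bool.Properties using (T-≡; T-∧)
open import Data.List using (List; length; tabulate; allFin; cartesianProduct; map; _++_)
open import Data.List.Base using (filterᵇ)
open import Data.List.Properties using (length-++; filter-++; map-tabulate)
open import Data.List.Relation.Unary.Any using (satisfied)
open import Data.List.Relation.Unary.Any.Properties using (any⁻)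
open import Data.Empty using (⊥; ⊥-elim)
open import Data.Unit using (tt)
open import Data.Sum using (_⊎_; inj₁; inj₂; [_,_]′)
open import Data.Product using (∃-syntax; _×_; _,_; proj₁; proj₂)
open import Relation.Unary using (Pred; Decidable; _∪_)
open import Relation.Unary.Properties using (_∪?_)
open import Relation.Nullary using (¬_; Dec; yes; no; does; _because_; _×-dec_; _⊎-dec_; ¬?; contradiction)
open import Relation.Nullary.Reflects using (fromEquivalence)
open import Relation.Binary.Definitions using (tri<; tri≈; tri>)
open import Relation.Binary.PropositionalEquality
  using (_≡_; _≢_; refl; sym; trans; cong; cong₂; subst; module ≡-Reasoning)
open import Function using (_∘_; id; Equivalence)
open import Function.Bundles using (_⇔_)

⟦_⟧ : Bool → ℕ
⟦ true ⟧  = 1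
⟦ false ⟧ = 0

𝟙 : {P : Set} → Dec P → ℕ
𝟙 P? = ⟦ does P? ⟧

-- Its decision is b itself, so 𝟙 (isTrue? b) computes to ⟦ b ⟧ and matches the counts in Defs.
isTrue? : (b : Bool) → Dec (b ≡ true)
isTrue? b = b because fromEquivalence (Equivalence.to T-≡) (Equivalence.from T-≡)

𝟙-split : {P Q : Set} (P? : Dec P) (Q? : Dec Q) → 𝟙 P? ≡ 𝟙 (P? ×-dec Q?) + 𝟙 (P? ×-dec ¬? Q?)
𝟙-split (no _)  _       = refl
𝟙-split (yes _) (yes _) = refl
𝟙-split (yes _) (no _)  = refl

⟦∧∨⟧≤ : ∀ r x y → ⟦ r ∧ (x ∨ y) ⟧ ≤ ⟦ r ∧ x ⟧ + ⟦ r ∧ y ⟧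
⟦∧∨⟧≤ false x     y = z≤n
⟦∧∨⟧≤ true  true  y = s≤s z≤n
⟦∧∨⟧≤ true  false y = ≤-refl

T-does : {P : Set} (P? : Dec P) → T (does P?) → P
T-does (yes p) _ = p

T-any-allFin : ∀ {n} (p : Fin n → Bool) → T (any p (allFin n)) → ∃[ i ] T (p i)
T-any-allFin {n} p = satisfied ∘ any⁻ p (allFin n)

𝟙-yes : {P : Set} (P? : Dec P) → P → 𝟙 P? ≡ 1
𝟙-yes (yes _) _ = refl
𝟙-yes (no ¬p) p = contradiction p ¬p

∑-mono-≤ : ∀ {n} {f g : Fin n → ℕ} → (∀ i → f i ≤ g i) → ∑[ i < n ] f i ≤ ∑[ i < n ] g i
∑-mono-≤ {zero}  _   = z≤n
∑-mono-≤ {suc n} f≤g = +-mono-≤ (f≤g zero) (∑-mono-≤ (f≤g ∘ suc))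

term≤∑ : ∀ {n} (f : Fin n → ℕ) i → f i ≤ ∑[ j < n ] f j
term≤∑ f zero    = m≤m+n _ _
term≤∑ f (suc i) = ≤-trans (term≤∑ (f ∘ suc) i) (m≤n+m _ (f zero))

∑-distrib-+₃ : ∀ {n} (f g h : Fin n → ℕ) →
               ∑[ i < n ] (f i + (g i + h i)) ≡ ∑[ i < n ] f i + (∑[ i < n ] g i + ∑[ i < n ] h i)
∑-distrib-+₃ f g h = trans (∑-distrib-+ f (λ i → g i + h i)) (cong (∑[ i < _ ] f i +_) (∑-distrib-+ g h))

∑-const : ∀ n c → ∑[ i < n ] c ≡ n * c
∑-const zero    c = refl
∑-const (suc n) c = cong (c +_) (∑-const n c)

𝟙≤∑𝟙 : ∀ {n} {P : Pred (Fin n) 0ℓ} (P? : Decidable P) {i} → P i → 1 ≤ ∑[ j < n ] 𝟙 (P? j)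
𝟙≤∑𝟙 P? {i} p = ≤-trans (≤-reflexive (sym (𝟙-yes (P? i) p))) (term≤∑ _ i)

∑𝟙-none : ∀ {n} {P : Pred (Fin n) 0ℓ} (P? : Decidable P) → (∀ i → ¬ P i) → ∑[ i < n ] 𝟙 (P? i) ≡ 0
∑𝟙-none {zero}  P? ¬P = refl
∑𝟙-none {suc n} P? ¬P with P? zero
... | yes p = contradiction p (¬P zero)
... | no  _ = ∑𝟙-none (P? ∘ suc) (¬P ∘ suc)

∑𝟙≤1 : ∀ {n} {P : Pred (Fin n) 0ℓ} (P? : Decidable P) →
       (∀ {i j} → P i → P j → i ≡ j) → ∑[ i < n ] 𝟙 (P? i) ≤ 1
∑𝟙≤1 {zero}  P? unique = z≤n
∑𝟙≤1 {suc n} P? unique with P? zero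
... | yes p = ≤-reflexive (cong suc (∑𝟙-none (P? ∘ suc) (λ i pᵢ → 0≢1+n (unique p pᵢ))))
... | no  _ = ∑𝟙≤1 (P? ∘ suc) (λ p q → suc-injective (unique p q))

∑𝟙≤𝟙 : ∀ {n} {P : Pred (Fin n) 0ℓ} {Q : Set} (P? : Decidable P) (Q? : Dec Q) →
       (∀ {i j} → P i → P j → i ≡ j) → (∀ {i} → P i → Q) → ∑[ i < n ] 𝟙 (P? i) ≤ 𝟙 Q?
∑𝟙≤𝟙 P? (yes _) unique _ = ∑𝟙≤1 P? unique
∑𝟙≤𝟙 P? (no ¬q) _ P⇒Q = ≤-reflexive (∑𝟙-none P? (λ i → ¬q ∘ P⇒Q))

∑∑-comm : ∀ {m n k l} (f : Fin m → Fin n → Fin k → Fin l → ℕ) →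
          ∑[ x < m ] ∑[ y < n ] ∑[ a < k ] ∑[ b < l ] f x y a b
        ≡ ∑[ a < k ] ∑[ b < l ] ∑[ x < m ] ∑[ y < n ] f x y a b
∑∑-comm f = begin
  ∑[ x < _ ] ∑[ y < _ ] ∑[ a < _ ] ∑[ b < _ ] f x y a b
    ≡⟨ sum-cong-≗ (λ x → ∑-comm (λ y a → ∑[ b < _ ] f x y a b)) ⟩
  ∑[ x < _ ] ∑[ a < _ ] ∑[ y < _ ] ∑[ b < _ ] f x y a b
    ≡⟨ ∑-comm (λ x a → ∑[ y < _ ] ∑[ b < _ ] f x y a b) ⟩
  ∑[ a < _ ] ∑[ x < _ ] ∑[ y < _ ] ∑[ b < _ ] f x y a b
    ≡⟨ sum-cong-≗ (λ a → sum-cong-≗ (λ x → ∑-comm (λ y b → f x y a b))) ⟩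
  ∑[ a < _ ] ∑[ x < _ ] ∑[ b < _ ] ∑[ y < _ ] f x y a b
    ≡⟨ sum-cong-≗ (λ a → ∑-comm (λ x b → ∑[ y < _ ] f x y a b)) ⟩
  ∑[ a < _ ] ∑[ b < _ ] ∑[ x < _ ] ∑[ y < _ ] f x y a b ∎
  where open ≡-Reasoning

∑-select : ∀ {n} (x : Fin n) c → ∑[ v < n ] (𝟙 (x ≟ v) * c) ≡ c
∑-select {suc n} zero    c = begin
  1 * c + ∑[ v < n ] (0 * c) ≡⟨ cong₂ _+_ (*-identityˡ c) (∑-const n 0) ⟩
  c + n * 0                  ≡⟨ cong (c +_) (*-zeroʳ n) ⟩
  c + 0                      ≡⟨ +-identityʳ c ⟩
  c                          ∎
  where open ≡-Reasoning
∑-select {suc n} (suc x) c = ∑-select x c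

∑𝟙-covering : ∀ {m n} {P : Pred (Fin m) 0ℓ} {Q : Pred (Fin n) 0ℓ} {R : Fin n → Fin m → Set}
              (P? : Decidable P) (Q? : Decidable Q) (R? : ∀ y x → Dec (R y x)) →
              (∀ {y} → Q y → ∃[ x ] (P x × R y x)) →
              (∀ {x y y′} → P x → R y x → R y′ x → y ≡ y′) →
              ∑[ y < n ] 𝟙 (Q? y) ≤ ∑[ x < m ] 𝟙 (P? x)
∑𝟙-covering {m} {n} P? Q? R? cover unique = begin
  ∑[ y < n ] 𝟙 (Q? y)                            ≤⟨ ∑-mono-≤ covered ⟩
  ∑[ y < n ] ∑[ x < m ] 𝟙 (P? x ×-dec R? y x)    ≡⟨ ∑-comm (λ y x → 𝟙 (P? x ×-dec R? y x)) ⟩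
  ∑[ x < m ] ∑[ y < n ] 𝟙 (P? x ×-dec R? y x)    ≤⟨ ∑-mono-≤ fibre ⟩
  ∑[ x < m ] 𝟙 (P? x)                            ∎
  where
  open ≤-Reasoning
  covered : ∀ y → 𝟙 (Q? y) ≤ ∑[ x < m ] 𝟙 (P? x ×-dec R? y x)
  covered y with Q? y
  ... | no  _ = z≤n
  ... | yes q with x , p , r ← cover q = 𝟙≤∑𝟙 (λ x → P? x ×-dec R? y x) (p , r)
  fibre : ∀ x → ∑[ y < n ] 𝟙 (P? x ×-dec R? y x) ≤ 𝟙 (P? x)
  fibre x = ∑𝟙≤𝟙 (λ y → P? x ×-dec R? y x) (P? x) (λ (p , r) (_ , r′) → unique p r r′) proj₁

∑∑𝟙-covering : ∀ {m n} {P : Fin m → Fin m → Set} {Q : Fin n → Fin n → Set}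
               {R : Fin n → Fin n → Fin m → Fin m → Set}
               (P? : ∀ a b → Dec (P a b)) (Q? : ∀ x y → Dec (Q x y))
               (R? : ∀ x y a b → Dec (R x y a b)) →
               (∀ {x y} → Q x y → ∃[ a ] ∃[ b ] (P a b × R x y a b)) →
               (∀ {a b x y x′ y′} → P a b → R x y a b → R x′ y′ a b → x ≡ x′ × y ≡ y′) →
               ∑[ x < n ] ∑[ y < n ] 𝟙 (Q? x y) ≤ ∑[ a < m ] ∑[ b < m ] 𝟙 (P? a b)
∑∑𝟙-covering {m} {n} P? Q? R? cover unique = begin
  ∑[ x < n ] ∑[ y < n ] 𝟙 (Q? x y)
    ≤⟨ ∑-mono-≤ (λ x → ∑-mono-≤ (covered x)) ⟩
  ∑[ x < n ] ∑[ y < n ] ∑[ a < m ] ∑[ b < m ] 𝟙 (P? a b ×-dec R? x y a b)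
    ≡⟨ ∑∑-comm (λ x y a b → 𝟙 (P? a b ×-dec R? x y a b)) ⟩
  ∑[ a < m ] ∑[ b < m ] ∑[ x < n ] ∑[ y < n ] 𝟙 (P? a b ×-dec R? x y a b)
    ≤⟨ ∑-mono-≤ (λ a → ∑-mono-≤ (fibre a)) ⟩
  ∑[ a < m ] ∑[ b < m ] 𝟙 (P? a b) ∎
  where
  open ≤-Reasoning
  covered : ∀ x y → 𝟙 (Q? x y) ≤ ∑[ a < m ] ∑[ b < m ] 𝟙 (P? a b ×-dec R? x y a b)
  covered x y with Q? x y
  ... | no  _ = z≤n
  ... | yes q with a , b , p , r ← cover q =
    ≤-trans (𝟙≤∑𝟙 (λ b → P? a b ×-dec R? x y a b) (p , r)) (term≤∑ _ a)
  row : ∀ a b x → ∑[ y < n ] 𝟙 (P? a b ×-dec R? x y a b)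
                ≤ 𝟙 (P? a b ×-dec any? (λ y → R? x y a b))
  row a b x = ∑𝟙≤𝟙 (λ y → P? a b ×-dec R? x y a b) (P? a b ×-dec any? (λ y → R? x y a b))
    (λ (p , r) (_ , r′) → proj₂ (unique p r r′)) (λ (p , r) → p , _ , r)
  fibre : ∀ a b → ∑[ x < n ] ∑[ y < n ] 𝟙 (P? a b ×-dec R? x y a b) ≤ 𝟙 (P? a b)
  fibre a b = ≤-trans (∑-mono-≤ (row a b))
    (∑𝟙≤𝟙 (λ x → P? a b ×-dec any? (λ y → R? x y a b)) (P? a b)
      (λ (p , _ , r) (_ , _ , r′) → proj₁ (unique p r r′)) proj₁)

length-filterᵇ-tabulate : ∀ {A : Set} {m} (p : A → Bool) (f : Fin m → A) →
                          length (filterᵇ p (tabulate f)) ≡ ∑[ i < m ] ⟦ p (f i) ⟧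
length-filterᵇ-tabulate {m = zero}  p f = refl
length-filterᵇ-tabulate {m = suc m} p f with p (f zero)
... | true  = cong suc (length-filterᵇ-tabulate p (f ∘ suc))
... | false = length-filterᵇ-tabulate p (f ∘ suc)

length-filterᵇ-allFin : ∀ {m} (p : Fin m → Bool) →
                        length (filterᵇ p (allFin m)) ≡ ∑[ i < m ] ⟦ p i ⟧
length-filterᵇ-allFin p = length-filterᵇ-tabulate p id

length-filterᵇ-cartesianProduct : ∀ {A B : Set} {m n} (p : A × B → Bool) (f : Fin m → A) (g : Fin n → B) →
  length (filterᵇ p (cartesianProduct (tabulate f) (tabulate g)))
  ≡ ∑[ i < m ] ∑[ j < n ] ⟦ p (f i , g j) ⟧
length-filterᵇ-cartesianProduct {m = zero}  p f g = refl
length-filterᵇ-cartesianProduct {A} {B} {suc m} {n} p f g = begin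
  length (filterᵇ p (map (f zero ,_) (tabulate g) ++ rest))
    ≡⟨ cong length (filter-++ _ (map (f zero ,_) (tabulate g)) rest) ⟩
  length (filterᵇ p (map (f zero ,_) (tabulate g)) ++ filterᵇ p rest)
    ≡⟨ length-++ (filterᵇ p (map (f zero ,_) (tabulate g))) ⟩
  length (filterᵇ p (map (f zero ,_) (tabulate g))) + length (filterᵇ p rest)
    ≡⟨ cong₂ _+_ (trans (cong (length ∘ filterᵇ p) (map-tabulate g (f zero ,_)))
                        (length-filterᵇ-tabulate p (λ j → f zero , g j)))
                 (length-filterᵇ-cartesianProduct p (f ∘ suc) g) ⟩
  ∑[ j < n ] ⟦ p (f zero , g j) ⟧ + ∑[ i < m ] ∑[ j < n ] ⟦ p (f (suc i) , g j) ⟧ ∎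
  where
  open ≡-Reasoning
  rest : List (A × B)
  rest = cartesianProduct (tabulate (f ∘ suc)) (tabulate g)

∑𝟙-image-≤ : ∀ {m n} {Q : Pred (Fin n) 0ℓ} (Q? : Decidable Q) (f : Fin m → Fin n) →
             (∀ {y} → Q y → ∃[ x ] f x ≡ y) → ∑[ y < n ] 𝟙 (Q? y) ≤ m
∑𝟙-image-≤ {m} Q? f image = begin
  ∑[ y < _ ] 𝟙 (Q? y)       ≤⟨ ∑𝟙-covering (λ _ → yes tt) Q? (λ y x → f x ≟ y)
                                 (λ q → let x , fx≡y = image q in x , tt , fx≡y)
                                 (λ _ fx≡y fx≡y′ → trans (sym fx≡y) fx≡y′) ⟩
  ∑[ x < m ] 1               ≡⟨ ∑-const m 1 ⟩
  m * 1                      ≡⟨ *-identityʳ m ⟩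
  m                          ∎
  where open ≤-Reasoning

module Rotation (H : Map) where
  open Map H

  σ-tail : ∀ d → tail (σ d) ≡ tail d
  σ-tail d = sym (Equivalence.from (σ-vertex d (σ d)) (1 , refl))

  iterσ-tail : ∀ i d → tail (iter σ i d) ≡ tail d
  iterσ-tail zero    d = refl
  iterσ-tail (suc i) d = trans (σ-tail _) (iterσ-tail i d)

  iterσ-+ : ∀ i j d → iter σ (i + j) d ≡ iter σ i (iter σ j d)
  iterσ-+ zero    j d = refl
  iterσ-+ (suc i) j d = cong σ (iterσ-+ i j d)

  σ-injective : ∀ {d d′} → σ d ≡ σ d′ → d ≡ d′
  σ-injective {d} {d′} eq = trans (sym (σ-left d)) (trans (cong σ⁻¹ eq) (σ-left d′))

  iterσ-injective : ∀ i {d d′} → iter σ i d ≡ iter σ i d′ → d ≡ d′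
  iterσ-injective zero    eq = eq
  iterσ-injective (suc i) eq = iterσ-injective i (σ-injective eq)

  iterσ-period-* : ∀ {p d} → iter σ p d ≡ d → ∀ q → iter σ (q * p) d ≡ d
  iterσ-period-*         σᵖd≡d zero    = refl
  iterσ-period-* {p} {d} σᵖd≡d (suc q) =
    trans (iterσ-+ p (q * p) d) (trans (cong (iter σ p) (iterσ-period-* σᵖd≡d q)) σᵖd≡d)

  degM≡∑ : ∀ v → degM H v ≡ ∑[ d < D ] 𝟙 (tail d ≟ v)
  degM≡∑ v = length-filterᵇ-allFin (λ d → true ∧ (tail d == v))

  σ-orbit : ∀ d → Fin (suc (degM H (tail d))) → Fin D
  σ-orbit d i = iter σ (toℕ i) d

  -- Pigeonhole: the deg + 1 darts σ-orbit d i all lie at the vertex of d, which has only deg darts.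
  rotation-period : ∀ d → ∃[ p ] (0 < p × p ≤ degM H (tail d) × iter σ p d ≡ d)
  rotation-period d with any? (λ i → any? (λ j → (i <ᶠ? j) ×-dec (σ-orbit d i ≟ σ-orbit d j)))
  ... | yes (i , j , i<j , σⁱd≡σʲd) =
    toℕ j ∸ toℕ i , m<n⇒0<n∸m i<j , ≤-trans (m∸n≤m (toℕ j) (toℕ i)) (s≤s⁻¹ (toℕ<n j)) ,
    iterσ-injective (toℕ i) (begin
      iter σ (toℕ i) (iter σ (toℕ j ∸ toℕ i) d) ≡⟨ iterσ-+ (toℕ i) (toℕ j ∸ toℕ i) d ⟨
      iter σ (toℕ i + (toℕ j ∸ toℕ i)) d        ≡⟨ cong (λ k → iter σ k d) (m+[n∸m]≡n (<⇒≤ i<j)) ⟩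
      iter σ (toℕ j) d                          ≡⟨ σⁱd≡σʲd ⟨
      iter σ (toℕ i) d                          ∎)
    where open ≡-Reasoning
  ... | no no-collision = contradiction too-many 1+n≰n
    where
    orbit-injective : ∀ {i j} → σ-orbit d i ≡ σ-orbit d j → i ≡ j
    orbit-injective {i} {j} eq with <-cmpᶠ i j
    ... | tri< i<j _ _ = contradiction (i , j , i<j , eq) no-collision
    ... | tri≈ _ i≡j _ = i≡j
    ... | tri> _ _ j<i = contradiction (j , i , j<i , sym eq) no-collision
    too-many : suc (degM H (tail d)) ≤ degM H (tail d)
    too-many = begin
      suc (degM H (tail d))                       ≡⟨ *-identityʳ _ ⟨
      suc (degM H (tail d)) * 1                   ≡⟨ ∑-const (suc (degM H (tail d))) 1 ⟨
      ∑[ i < suc (degM H (tail d)) ] 𝟙 (yes tt)   ≤⟨ ∑𝟙-covering (λ d′ → tail d′ ≟ tail d) (λ _ → yes tt)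
                                                       (λ i d′ → σ-orbit d i ≟ d′)
                                                       (λ {i} _ → σ-orbit d i , iterσ-tail (toℕ i) d , refl)
                                                       (λ _ eq eq′ → orbit-injective (trans eq (sym eq′))) ⟩
      ∑[ d′ < D ] 𝟙 (tail d′ ≟ tail d)           ≡⟨ degM≡∑ (tail d) ⟨
      degM H (tail d)                             ∎
      where open ≤-Reasoning

  rotation-reaches : ∀ d a → tail d ≡ tail a → ∃[ i ] (i < degM H (tail d) × iter σ i d ≡ a)
  rotation-reaches d a same
    with m , σᵐd≡a ← Equivalence.to (σ-vertex d a) same
       | suc p-1 , _ , p≤deg , σᵖd≡d ← rotation-period d
    = m % p , <-≤-trans (m%n<n m p) p≤deg , (begin
      iter σ (m % p) d                         ≡⟨ cong (iter σ (m % p)) (sym (iterσ-period-* σᵖd≡d (m / p))) ⟩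
      iter σ (m % p) (iter σ ((m / p) * p) d)  ≡⟨ sym (iterσ-+ (m % p) _ d) ⟩
      iter σ (m % p + (m / p) * p) d           ≡⟨ cong (λ k → iter σ k d) (sym (m≡m%n+[m/n]*n m p)) ⟩
      iter σ m d                               ≡⟨ σᵐd≡a ⟩
      a                                        ∎)
    where
    open ≡-Reasoning
    p = suc p-1

  -- The origin dart at v from which positions in the rotation at v are measured;
  -- it depends only on v (the fallback is never used for v = tail a).
  firstDartAt : Fin N → Fin D → Fin D
  firstDartAt v fallback with any? (λ d → tail d ≟ v)
  ... | yes (d , _) = d
  ... | no  _       = fallback

  firstDartAt-tail : ∀ a → tail (firstDartAt (tail a) a) ≡ tail a
  firstDartAt-tail a with any? (λ d → tail d ≟ tail a)
  ... | yes (_ , td) = td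
  ... | no  _        = refl

  firstDartAt-irrelevant : ∀ v a b → tail a ≡ v → firstDartAt v a ≡ firstDartAt v b
  firstDartAt-irrelevant v a b ta with any? (λ d → tail d ≟ v)
  ... | yes _ = refl
  ... | no ¬∃ = contradiction (a , ta) ¬∃

  origin : Fin D → Fin D
  origin a = firstDartAt (tail a) a

  origin-cong : ∀ {a b} → tail a ≡ tail b → origin a ≡ origin b
  origin-cong {a} {b} same =
    trans (firstDartAt-irrelevant (tail a) a b refl) (cong (λ v → firstDartAt v b) same)

  opaque
    position : Fin D → ℕ
    position a = proj₁ (rotation-reaches (origin a) a (firstDartAt-tail a))

    position-< : ∀ a → position a < degM H (tail a)
    position-< a = subst (λ v → position a < degM H v) (firstDartAt-tail a)
                         (proj₁ (proj₂ (rotation-reaches (origin a) a (firstDartAt-tail a))))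

    iterσ-position : ∀ a → iter σ (position a) (origin a) ≡ a
    iterσ-position a = proj₂ (proj₂ (rotation-reaches (origin a) a (firstDartAt-tail a)))

  iterσ-position-from : ∀ {a x} → tail x ≡ tail a → iter σ (position x) (origin a) ≡ x
  iterσ-position-from {a} {x} x∼a = trans (cong (iter σ (position x)) (origin-cong (sym x∼a))) (iterσ-position x)

  position-injective : ∀ {a b} → tail a ≡ tail b → position a ≡ position b → a ≡ b
  position-injective {a} {b} same eq = begin
    a                                   ≡⟨ iterσ-position a ⟨
    iter σ (position a) (origin a)      ≡⟨ cong (λ i → iter σ i (origin a)) eq ⟩
    iter σ (position b) (origin a)      ≡⟨ iterσ-position-from (sym same) ⟩
    b                                   ∎
    where open ≡-Reasoning

module Degrees (H : Map) (RV : Fin (Map.N H) → Bool) (RE : Fin (Map.D H) → Bool) where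
  open Map H

  deg : Fin N → ℕ
  deg = degR H RV RE

  deg≡∑ : ∀ v → deg v ≡ ∑[ d < D ] 𝟙 (isTrue? (RE d) ×-dec (tail d ≟ v))
  deg≡∑ v = length-filterᵇ-allFin (λ d → RE d ∧ (tail d == v))

  V=1? : Decidable (V=1 H RV RE)
  V=1? v = isTrue? (RV v) ×-dec (deg v ℕ.≟ 1)

  V≥3? : Decidable (V≥3 H RV RE)
  V≥3? v = isTrue? (RV v) ×-dec (3 ≤? deg v)

  V★2? : Decidable (V★2 H RV RE)
  V★2? v = (isTrue? (RV v) ×-dec (deg v ℕ.≟ 2)) ×-dec
           any? (λ d → isTrue? (RE d) ×-dec (tail d ≟ v) ×-dec (V=1? (head H d) ⊎-dec V≥3? (head H d)))

  #_ : {X : Pred (Fin N) 0ℓ} → Decidable X → ℕ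
  # X? = ∑[ v < N ] 𝟙 (X? v)

  dartsAt : {X : Pred (Fin N) 0ℓ} → Decidable X → ℕ
  dartsAt X? = ∑[ d < D ] 𝟙 (isTrue? (RE d) ×-dec X? (tail d))

  private
    𝟙-transpose : ∀ {X : Pred (Fin N) 0ℓ} (X? : Decidable X) r t v →
                  𝟙 (X? v) * 𝟙 (isTrue? r ×-dec (t ≟ v)) ≡ 𝟙 (t ≟ v) * 𝟙 (isTrue? r ×-dec X? t)
    𝟙-transpose X? r t v with t ≟ v | r
    ... | no  _    | true  = *-zeroʳ (𝟙 (X? v))
    ... | no  _    | false = *-zeroʳ (𝟙 (X? v))
    ... | yes refl | true  = *-comm (𝟙 (X? t)) 1
    ... | yes refl | false = *-zeroʳ (𝟙 (X? t))

  dartsAt-handshake : ∀ {X : Pred (Fin N) 0ℓ} (X? : Decidable X) → dartsAt X? ≡ ∑[ v < N ] (𝟙 (X? v) * deg v)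
  dartsAt-handshake X? = sym (begin
    ∑[ v < N ] (𝟙 (X? v) * deg v)
      ≡⟨ sum-cong-≗ (λ v → trans (cong (𝟙 (X? v) *_) (deg≡∑ v))
                                  (*-distribˡ-sum (𝟙 (X? v)) (λ d → 𝟙 (isTrue? (RE d) ×-dec (tail d ≟ v))))) ⟩
    ∑[ v < N ] ∑[ d < D ] (𝟙 (X? v) * 𝟙 (isTrue? (RE d) ×-dec (tail d ≟ v)))
      ≡⟨ ∑-comm (λ v d → 𝟙 (X? v) * 𝟙 (isTrue? (RE d) ×-dec (tail d ≟ v))) ⟩
    ∑[ d < D ] ∑[ v < N ] (𝟙 (X? v) * 𝟙 (isTrue? (RE d) ×-dec (tail d ≟ v)))
      ≡⟨ sum-cong-≗ (λ d → trans (sum-cong-≗ (𝟙-transpose X? (RE d) (tail d)))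
                                  (∑-select (tail d) (𝟙 (isTrue? (RE d) ×-dec X? (tail d))))) ⟩
    dartsAt X? ∎)
    where open ≡-Reasoning

  dartsAt-∪ : ∀ {X Y : Pred (Fin N) 0ℓ} (X? : Decidable X) (Y? : Decidable Y) →
              dartsAt (X? ∪? Y?) ≤ dartsAt X? + dartsAt Y?
  dartsAt-∪ X? Y? = ≤-trans (∑-mono-≤ (λ d → ⟦∧∨⟧≤ (RE d) _ _))
    (≤-reflexive (∑-distrib-+ (λ d → 𝟙 (isTrue? (RE d) ×-dec X? (tail d)))
                              (λ d → 𝟙 (isTrue? (RE d) ×-dec Y? (tail d)))))

  dartsAt-regular : ∀ {X : Pred (Fin N) 0ℓ} (X? : Decidable X) c →
                    (∀ {v} → X v → deg v ≡ c) → dartsAt X? ≡ c * # X?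
  dartsAt-regular X? c regular = begin
    dartsAt X?                       ≡⟨ dartsAt-handshake X? ⟩
    ∑[ v < N ] (𝟙 (X? v) * deg v)    ≡⟨ sum-cong-≗ pointwise ⟩
    ∑[ v < N ] (c * 𝟙 (X? v))        ≡⟨ *-distribˡ-sum c (λ v → 𝟙 (X? v)) ⟨
    c * # X?                         ∎
    where
    open ≡-Reasoning
    pointwise : ∀ v → 𝟙 (X? v) * deg v ≡ c * 𝟙 (X? v)
    pointwise v with X? v
    ... | yes x = trans (*-identityˡ (deg v)) (trans (regular x) (sym (*-identityʳ c)))
    ... | no  _ = sym (*-zeroʳ c)

  dartsAt-V=1 : dartsAt V=1? ≡ # V=1?
  dartsAt-V=1 = trans (dartsAt-regular V=1? 1 proj₂) (*-identityˡ (# V=1?))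

  dartsAt-V★2 : dartsAt V★2? ≡ 2 * # V★2?
  dartsAt-V★2 = dartsAt-regular V★2? 2 (proj₂ ∘ proj₁)

  deg-pos : ∀ {d} → RE d ≡ true → 1 ≤ deg (tail d)
  deg-pos {d} re = ≤-trans (𝟙≤∑𝟙 (λ e → isTrue? (RE e) ×-dec (tail e ≟ tail d)) (re , refl))
                           (≤-reflexive (sym (deg≡∑ (tail d))))

  Reach-from-isolated : ∀ {x u} → Reach H RE x u → deg x ≡ 0 → x ≡ u
  Reach-from-isolated here             _    = refl
  Reach-from-isolated (step d re _) deg≡0 with () ← ≤-trans (deg-pos re) (≤-reflexive deg≡0)

  distinct-darts≤deg : ∀ {m} (f : Fin m → Fin D) v → (∀ i → RE (f i) ≡ true × tail (f i) ≡ v) →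
                        (∀ {i j} → f i ≡ f j → i ≡ j) → m ≤ deg v
  distinct-darts≤deg {m} f v at-v injective = begin
    m                                                ≡⟨ *-identityʳ m ⟨
    m * 1                                            ≡⟨ ∑-const m 1 ⟨
    ∑[ i < m ] 1                                     ≤⟨ ∑𝟙-covering (λ d → isTrue? (RE d) ×-dec (tail d ≟ v))
                                                          (λ _ → yes tt) (λ i d → f i ≟ d)
                                                          (λ {i} _ → f i , at-v i , refl)
                                                          (λ _ fi≡d fj≡d → injective (trans fi≡d (sym fj≡d))) ⟩
    ∑[ d < D ] 𝟙 (isTrue? (RE d) ×-dec (tail d ≟ v)) ≡⟨ deg≡∑ v ⟨
    deg v                                            ∎
    where open ≤-Reasoning

  private
    branch-inequality : ∀ n → n ≢ 0 → 𝟙 (3 ≤? n) * n + 6 * 1 ≤ 3 * 𝟙 (n ℕ.≟ 1) + 3 * (1 * n)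
    branch-inequality zero                n≢0 = contradiction refl n≢0
    branch-inequality (suc zero)          _   = ≤-refl
    branch-inequality (suc (suc zero))    _   = ≤-refl
    branch-inequality n@(suc (suc (suc _))) _ = begin
      1 * n + 6        ≡⟨ cong (_+ 6) (*-identityˡ n) ⟩
      n + (3 + 3)      ≤⟨ +-monoʳ-≤ n (+-mono-≤ (s≤s (s≤s (s≤s z≤n))) (s≤s (s≤s (s≤s z≤n)))) ⟩
      n + (n + n)      ≡⟨ cong (λ k → n + (n + k)) (+-identityʳ n) ⟨
      3 * n            ≡⟨ cong (3 *_) (*-identityˡ n) ⟨
      3 * (1 * n)      ∎
      where open ≤-Reasoning

    -- 6V = 3(E + 2) by the tree equation, so B + 6V ≤ 3L + 3E leaves B + 6 ≤ 3L.
    tree-arithmetic : ∀ {B L V E} → B + 6 * V ≤ 3 * L + 3 * E → 2 * V ≡ E + 2 → B ≤ 3 * L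
    tree-arithmetic {B} {L} {V} {E} bound euler = ≤-trans (m≤m+n B 6) (+-cancelʳ-≤ (3 * E) (B + 6) (3 * L) (begin
      B + 6 + 3 * E      ≡⟨ +-assoc B 6 (3 * E) ⟩
      B + (6 + 3 * E)    ≡⟨ cong (B +_) (+-comm 6 (3 * E)) ⟩
      B + (3 * E + 6)    ≡⟨ cong (B +_) (*-distribˡ-+ 3 E 2) ⟨
      B + 3 * (E + 2)    ≡⟨ cong (λ k → B + 3 * k) euler ⟨
      B + 3 * (2 * V)    ≡⟨ cong (B +_) (*-assoc 3 2 V) ⟨
      B + 6 * V          ≤⟨ bound ⟩
      3 * L + 3 * E      ∎))
      where open ≤-Reasoning

  dartsAt-V≥3≤3*#V=1 : IsSubtree H RV RE → dartsAt V≥3? ≤ 3 * # V=1?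
  dartsAt-V≥3≤3*#V=1 subtree with any? (λ v → isTrue? (RV v) ×-dec (deg v ℕ.≟ 0))
  ... | yes (v₀ , rv₀ , isolated) =
    ≤-trans (≤-reflexive (∑𝟙-none (λ d → isTrue? (RE d) ×-dec V≥3? (tail d)) no-V≥3-dart)) z≤n
    where
    open IsSubtree subtree
    no-V≥3-dart : ∀ d → ¬ (RE d ≡ true × V≥3 H RV RE (tail d))
    no-V≥3-dart d (_ , rv , 3≤deg) with refl ← Reach-from-isolated (connected v₀ (tail d) rv₀ rv) isolated
      with () ← subst (3 ≤_) isolated 3≤deg
  ... | no no-isolated =
    tree-arithmetic {dartsAt V≥3?} {# V=1?} {∑[ v < N ] ⟦ RV v ⟧} {∑[ d < D ] ⟦ RE d ⟧} (begin
    dartsAt V≥3? + 6 * ∑[ v < N ] ⟦ RV v ⟧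
      ≡⟨ cong₂ _+_ (dartsAt-handshake V≥3?) (*-distribˡ-sum 6 (λ v → ⟦ RV v ⟧)) ⟩
    ∑[ v < N ] (𝟙 (V≥3? v) * deg v) + ∑[ v < N ] (6 * ⟦ RV v ⟧)
      ≡⟨ ∑-distrib-+ (λ v → 𝟙 (V≥3? v) * deg v) (λ v → 6 * ⟦ RV v ⟧) ⟨
    ∑[ v < N ] (𝟙 (V≥3? v) * deg v + 6 * ⟦ RV v ⟧)
      ≤⟨ ∑-mono-≤ pointwise ⟩
    ∑[ v < N ] (3 * 𝟙 (V=1? v) + 3 * (⟦ RV v ⟧ * deg v))
      ≡⟨ ∑-distrib-+ (λ v → 3 * 𝟙 (V=1? v)) (λ v → 3 * (⟦ RV v ⟧ * deg v)) ⟩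
    ∑[ v < N ] (3 * 𝟙 (V=1? v)) + ∑[ v < N ] (3 * (⟦ RV v ⟧ * deg v))
      ≡⟨ cong₂ _+_ (*-distribˡ-sum 3 (λ v → 𝟙 (V=1? v))) (*-distribˡ-sum 3 (λ v → ⟦ RV v ⟧ * deg v)) ⟨
    3 * # V=1? + 3 * ∑[ v < N ] (⟦ RV v ⟧ * deg v)
      ≡⟨ cong (λ k → 3 * # V=1? + 3 * k) (trans (sym (dartsAt-handshake (isTrue? ∘ RV))) all-darts) ⟩
    3 * # V=1? + 3 * ∑[ d < D ] ⟦ RE d ⟧ ∎)
    (begin-equality
    2 * ∑[ v < N ] ⟦ RV v ⟧   ≡⟨ cong (2 *_) (length-filterᵇ-allFin RV) ⟨
    2 * count H RV             ≡⟨ tree ⟩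
    count H RE + 2             ≡⟨ cong (_+ 2) (length-filterᵇ-allFin RE) ⟩
    ∑[ d < D ] ⟦ RE d ⟧ + 2   ∎)
    where
    open IsSubtree subtree
    open ≤-Reasoning
    pointwise : ∀ v → 𝟙 (V≥3? v) * deg v + 6 * ⟦ RV v ⟧ ≤ 3 * 𝟙 (V=1? v) + 3 * (⟦ RV v ⟧ * deg v)
    pointwise v with RV v in rv
    ... | false = z≤n
    ... | true  = branch-inequality (deg v) (λ deg≡0 → no-isolated (v , rv , deg≡0))
    all-darts : dartsAt (isTrue? ∘ RV) ≡ ∑[ d < D ] ⟦ RE d ⟧
    all-darts = sum-cong-≗ λ d → tail-in-R d
      where
      tail-in-R : ∀ d → ⟦ RE d ∧ RV (tail d) ⟧ ≡ ⟦ RE d ⟧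
      tail-in-R d with RE d in re
      ... | false = refl
      ... | true  rewrite RE-tail d re = refl

  #V=1≤2*k : ∀ {n k} (ι : Fin n → Fin N) (s t : Fin k → Fin n) →
            (∀ {v} → V=1 H RV RE v → ∃[ i ] (v ≡ ι (s i) ⊎ v ≡ ι (t i))) → # V=1? ≤ 2 * k
  #V=1≤2*k {k = k} ι s t terminal = begin
    # V=1?        ≤⟨ ∑𝟙-image-≤ V=1? endpoint covered ⟩
    k + k         ≡⟨ cong (k +_) (+-identityʳ k) ⟨
    2 * k         ∎
    where
    open ≤-Reasoning
    endpoint : Fin (k + k) → Fin N
    endpoint = [ ι ∘ s , ι ∘ t ]′ ∘ splitAt k
    covered : ∀ {v} → V=1 H RV RE v → ∃[ x ] endpoint x ≡ v
    covered leaf with terminal leaf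
    ... | i , inj₁ v≡ιsᵢ = i ↑ˡ k , trans (cong [ ι ∘ s , ι ∘ t ]′ (splitAt-↑ˡ k i k)) (sym v≡ιsᵢ)
    ... | i , inj₂ v≡ιtᵢ = k ↑ʳ i , trans (cong [ ι ∘ s , ι ∘ t ]′ (splitAt-↑ʳ k k i)) (sym v≡ιtᵢ)

  #V★2≤#V=1+dartsAt-V≥3 : IsSubtree H RV RE → # V★2? ≤ # V=1? + dartsAt V≥3?
  #V★2≤#V=1+dartsAt-V≥3 subtree = begin
    # V★2?                        ≤⟨ ∑𝟙-covering (λ e → isTrue? (RE e) ×-dec (V=1? ∪? V≥3?) (tail e)) V★2?
                                       (λ v e → head H e ≟ v) covered
                                       (λ _ e↦v e↦v′ → trans (sym e↦v) e↦v′) ⟩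
    dartsAt (V=1? ∪? V≥3?)        ≤⟨ dartsAt-∪ V=1? V≥3? ⟩
    dartsAt V=1? + dartsAt V≥3?   ≡⟨ cong (_+ dartsAt V≥3?) dartsAt-V=1 ⟩
    # V=1? + dartsAt V≥3?         ∎
    where
    open ≤-Reasoning
    open IsSubtree subtree
    covered : ∀ {v} → V★2 H RV RE v →
              ∃[ e ] ((RE e ≡ true × (V=1 H RV RE ∪ V≥3 H RV RE) (tail e)) × head H e ≡ v)
    covered (_ , d , re , d↦v , end) = α d , (trans (RE-α d) re , end) , trans (cong tail (α-invol d)) d↦v

  three-distinct-darts⇒3≤deg : ∀ {v c a b} → c ≢ a → c ≢ b → a ≢ b →
          RE c ≡ true × tail c ≡ v → RE a ≡ true × tail a ≡ v → RE b ≡ true × tail b ≡ v → 3 ≤ deg v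
  three-distinct-darts⇒3≤deg {v} {c} {a} {b} c≢a c≢b a≢b c-at-v a-at-v b-at-v =
    distinct-darts≤deg dart v at-v injective
    where
    dart : Fin 3 → Fin D
    dart zero             = c
    dart (suc zero)       = a
    dart (suc (suc zero)) = b
    at-v : ∀ i → RE (dart i) ≡ true × tail (dart i) ≡ v
    at-v zero             = c-at-v
    at-v (suc zero)       = a-at-v
    at-v (suc (suc zero)) = b-at-v
    injective : ∀ {i j} → dart i ≡ dart j → i ≡ j
    injective {zero}           {zero}           _  = refl
    injective {zero}           {suc zero}       eq = contradiction eq c≢a
    injective {zero}           {suc (suc zero)} eq = contradiction eq c≢b
    injective {suc zero}       {zero}           eq = contradiction (sym eq) c≢a
    injective {suc zero}       {suc zero}       _  = refl
    injective {suc zero}       {suc (suc zero)} eq = contradiction eq a≢b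
    injective {suc (suc zero)} {zero}           eq = contradiction (sym eq) c≢b
    injective {suc (suc zero)} {suc zero}       eq = contradiction (sym eq) a≢b
    injective {suc (suc zero)} {suc (suc zero)} _  = refl

sorted-pair-unique : ∀ {n} {r s x y x′ y′ : Fin n} → toℕ x ≤ toℕ y → toℕ x′ ≤ toℕ y′ →
                     (r ≡ x × s ≡ y) ⊎ (r ≡ y × s ≡ x) → (r ≡ x′ × s ≡ y′) ⊎ (r ≡ y′ × s ≡ x′) →
                     x ≡ x′ × y ≡ y′
sorted-pair-unique _   _     (inj₁ (refl , refl)) (inj₁ (refl , refl)) = refl , refl
sorted-pair-unique _   _     (inj₂ (refl , refl)) (inj₂ (refl , refl)) = refl , refl
sorted-pair-unique x≤y x′≤y′ (inj₁ (refl , refl)) (inj₂ (refl , refl))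
  with refl ← toℕ-injective (≤-antisym x≤y x′≤y′) = refl , refl
sorted-pair-unique x≤y x′≤y′ (inj₂ (refl , refl)) (inj₁ (refl , refl))
  with refl ← toℕ-injective (≤-antisym x≤y x′≤y′) = refl , refl

module PairingCount (H : Map) (RV : Fin (Map.N H) → Bool) (RE : Fin (Map.D H) → Bool)
                    (pair : Fin (Map.N H) → Fin (Map.D H) → Fin (Map.D H) → Bool)
                    (pairing : IsPairing H RV RE pair) (non-crossing : NonCrossing H RV RE pair) where
  open Map H
  open Rotation H
  open Degrees H RV RE
  private module P = IsPairing pairing

  -- By IsPairing.support, pair v a b can hold only for v = tail a.
  Partners : Fin D → Fin D → Set
  Partners a b = pair (tail a) a b ≡ true

  partners-support : ∀ {a b} → Partners a b →
                     V★ H RV RE (tail a) × RE a ≡ true × RE b ≡ true × tail b ≡ tail a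
  partners-support {a} {b} p with v★ , ra , rb , _ , b∼a ← P.support (tail a) a b p = v★ , ra , rb , b∼a

  partner-tail : ∀ {a b} → Partners a b → tail b ≡ tail a
  partner-tail p = proj₂ (proj₂ (proj₂ (partners-support p)))

  partners-sym : ∀ {a b} → Partners a b → Partners b a
  partners-sym {a} {b} p =
    trans (cong (λ v → pair v b a) (partner-tail p)) (trans (P.sym (tail a) b a) p)

  partners-distinct⇒¬leaf : ∀ {a b} → Partners a b → a ≢ b → ¬ V=1 H RV RE (tail a)
  partners-distinct⇒¬leaf {a} {b} p a≢b leaf = a≢b (P.at-V=1 (tail a) a b leaf p)

  no-crossing : ∀ {a b c d} → Partners a b → Partners c d → tail c ≡ tail a →
                position a < position c → position c < position b → position b < position d → ⊥
  no-crossing {a} {b} {c} {d} pab pcd c∼a a<c c<b b<d =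
    non-crossing (tail a) a b c d (origin a) (position a) (position c) (position b) (position d)
      pab (subst (λ v → pair v c d ≡ true) c∼a pcd) (firstDartAt-tail a) a<c c<b b<d
      (subst (λ v → position d < degM H v) d∼a (position-< d))
      (iterσ-position a) (iterσ-position-from c∼a) (iterσ-position-from b∼a) (iterσ-position-from d∼a)
    where
    b∼a : tail b ≡ tail a
    b∼a = partner-tail pab
    d∼a : tail d ≡ tail a
    d∼a = trans (partner-tail pcd) c∼a

  Ordered : Fin D → Fin D → Set
  Ordered a b = Partners a b × position a ≤ position b

  Ordered? : ∀ a b → Dec (Ordered a b)
  Ordered? a b = isTrue? (pair (tail a) a b) ×-dec (position a ≤? position b)

  PartnerBefore : Fin D → Fin D → Set
  PartnerBefore a b = ∃[ c ] (Partners c b × position c < position a)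

  PartnerBefore? : ∀ a b → Dec (PartnerBefore a b)
  PartnerBefore? a b = any? (λ c → isTrue? (pair (tail c) c b) ×-dec (position c <? position a))

  Loop? : ∀ a b → Dec (Ordered a b × a ≡ b)
  Loop? a b = Ordered? a b ×-dec (a ≟ b)

  Distinct? : ∀ a b → Dec (Ordered a b × a ≢ b)
  Distinct? a b = Ordered? a b ×-dec ¬? (a ≟ b)

  Later? : ∀ a b → Dec ((Ordered a b × a ≢ b) × PartnerBefore a b)
  Later? a b = Distinct? a b ×-dec PartnerBefore? a b

  First? : ∀ a b → Dec ((Ordered a b × a ≢ b) × ¬ PartnerBefore a b)
  First? a b = Distinct? a b ×-dec ¬? (PartnerBefore? a b)

  ordered-split : ∀ a b → 𝟙 (Ordered? a b) ≡ 𝟙 (Loop? a b) + (𝟙 (Later? a b) + 𝟙 (First? a b))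
  ordered-split a b =
    trans (𝟙-split (Ordered? a b) (a ≟ b)) (cong (𝟙 (Loop? a b) +_) (𝟙-split (Distinct? a b) (PartnerBefore? a b)))

  loops-bound : ∀ a → ∑[ b < D ] 𝟙 (Loop? a b) ≤ 𝟙 (isTrue? (RE a) ×-dec (V=1? ∪? V★2?) (tail a))
  loops-bound a = ∑𝟙≤𝟙 (Loop? a) (isTrue? (RE a) ×-dec (V=1? ∪? V★2?) (tail a))
    (λ (_ , a≡b) (_ , a≡b′) → trans (sym a≡b) a≡b′) at-leaf-or-subdivision
    where
    at-leaf-or-subdivision : ∀ {b} → Ordered a b × a ≡ b → RE a ≡ true × (V=1 H RV RE ∪ V★2 H RV RE) (tail a)
    at-leaf-or-subdivision ((p , _) , refl) with partners-support p
    ... | inj₁ leaf          , ra , _ = ra , inj₁ leaf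
    ... | inj₂ (inj₁ branch) , _      = contradiction refl (P.at-V≥3 (tail a) a a branch p)
    ... | inj₂ (inj₂ sub)    , ra , _ = ra , inj₂ sub

  firsts-bound : ∀ b → ∑[ a < D ] 𝟙 (First? a b) ≤ 𝟙 (isTrue? (RE b) ×-dec (V≥3? ∪? V★2?) (tail b))
  firsts-bound b = ∑𝟙≤𝟙 (λ a → First? a b) (isTrue? (RE b) ×-dec (V≥3? ∪? V★2?) (tail b))
    unique at-branch-or-subdivision
    where
    unique : ∀ {a a′} → (Ordered a b × a ≢ b) × ¬ PartnerBefore a b →
             (Ordered a′ b × a′ ≢ b) × ¬ PartnerBefore a′ b → a ≡ a′
    unique {a} {a′} (((p , _) , _) , ¬before) (((p′ , _) , _) , ¬before′) with <-cmp (position a) (position a′)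
    ... | tri< a<a′ _ _ = contradiction (a , p , a<a′) ¬before′
    ... | tri> _ _ a′<a = contradiction (a′ , p′ , a′<a) ¬before
    ... | tri≈ _ a≈a′ _ = position-injective
      (trans (sym (partner-tail p)) (partner-tail p′)) a≈a′
    at-branch-or-subdivision : ∀ {a} → (Ordered a b × a ≢ b) × ¬ PartnerBefore a b →
                               RE b ≡ true × (V≥3 H RV RE ∪ V★2 H RV RE) (tail b)
    at-branch-or-subdivision (((p , _) , a≢b) , _) with partners-support p
    ... | inj₁ leaf          , _ = contradiction leaf (partners-distinct⇒¬leaf p a≢b)
    ... | inj₂ (inj₁ branch) , _ , rb , b∼a = rb , inj₁ (subst (V≥3 H RV RE) (sym b∼a) branch)
    ... | inj₂ (inj₂ sub)    , _ , rb , b∼a = rb , inj₂ (subst (V★2 H RV RE) (sym b∼a) sub)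

  laters-bound : ∀ a → ∑[ b < D ] 𝟙 (Later? a b) ≤ 𝟙 (isTrue? (RE a) ×-dec V≥3? (tail a))
  laters-bound a = ∑𝟙≤𝟙 (Later? a) (isTrue? (RE a) ×-dec V≥3? (tail a)) unique at-branch
    where
    a<b : ∀ {b} → Ordered a b → a ≢ b → position a < position b
    a<b (p , a≤b) a≢b = ≤∧≢⇒< a≤b (a≢b ∘ position-injective (sym (partner-tail p)))
    unique : ∀ {b b′} → (Ordered a b × a ≢ b) × PartnerBefore a b →
             (Ordered a b′ × a ≢ b′) × PartnerBefore a b′ → b ≡ b′
    unique {b} {b′} ((oab@(pab , _) , a≢b) , c , pcb , c<a) ((oab′@(pab′ , _) , a≢b′) , c′ , pc′b′ , c′<a)
      with <-cmp (position b) (position b′)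
    ... | tri< b<b′ _ _ = ⊥-elim (no-crossing pcb pab′ (trans (sym (partner-tail pab)) (partner-tail pcb))
                                             c<a (a<b oab a≢b) b<b′)
    ... | tri> _ _ b′<b = ⊥-elim (no-crossing pc′b′ pab (trans (sym (partner-tail pab′)) (partner-tail pc′b′))
                                             c′<a (a<b oab′ a≢b′) b′<b)
    ... | tri≈ _ b≈b′ _ = position-injective (trans (partner-tail pab) (sym (partner-tail pab′))) b≈b′
    at-branch : ∀ {b} → (Ordered a b × a ≢ b) × PartnerBefore a b → RE a ≡ true × V≥3 H RV RE (tail a)
    at-branch {b} (((p , a≤b) , a≢b) , c , pcb , c<a) with partners-support p
    ... | inj₁ leaf          , _ = contradiction leaf (partners-distinct⇒¬leaf p a≢b)
    ... | inj₂ (inj₁ branch) , ra , _ = ra , branch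
    ... | inj₂ (inj₂ ((_ , deg≡2) , _)) , ra , rb , b∼a
      = ⊥-elim (<-irrefl refl (subst (3 ≤_) deg≡2 (three-distinct-darts⇒3≤deg c≢a c≢b a≢b
                                                       (proj₁ (proj₂ (partners-support pcb)) , c∼a)
                                                       (ra , refl) (rb , b∼a))))
      where
      c∼a : tail c ≡ tail a
      c∼a = trans (sym (partner-tail pcb)) b∼a
      c≢a : c ≢ a
      c≢a = <⇒≢ c<a ∘ cong position
      c≢b : c ≢ b
      c≢b = <⇒≢ (<-≤-trans c<a a≤b) ∘ cong position

  rep : Fin D → Fin D
  rep = edgeRep H RV RE

  inUnion-witness : ∀ {x y} → inUnion H RV RE pair x y ≡ true →
                    ∃[ v ] ∃[ a ] ∃[ b ] (pair v a b ≡ true × rep a ≡ x × rep b ≡ y)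
  inUnion-witness {x} {y} inU
    with v , Tv ← T-any-allFin (λ v → any (λ a → any (λ b → pair v a b ∧ ((rep a == x) ∧ (rep b == y)))
                                    (allFin D)) (allFin D)) (Equivalence.from T-≡ inU)
    with a , Ta ← T-any-allFin (λ a → any (λ b → pair v a b ∧ ((rep a == x) ∧ (rep b == y))) (allFin D)) Tv
    with b , Tb ← T-any-allFin (λ b → pair v a b ∧ ((rep a == x) ∧ (rep b == y))) Ta
    with Tp , Tab ← Equivalence.to (T-∧ {pair v a b} {(rep a == x) ∧ (rep b == y)}) Tb
    with Ta≡x , Tb≡y ← Equivalence.to (T-∧ {rep a == x} {rep b == y}) Tab
    = v , a , b , Equivalence.to T-≡ Tp , T-does (rep a ≟ x) Ta≡x , T-does (rep b ≟ y) Tb≡y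

  SameEdges : Fin D → Fin D → Fin D → Fin D → Set
  SameEdges x y a b = (rep a ≡ x × rep b ≡ y) ⊎ (rep a ≡ y × rep b ≡ x)

  SameEdges? : ∀ x y a b → Dec (SameEdges x y a b)
  SameEdges? x y a b = (rep a ≟ x ×-dec rep b ≟ y)
                ⊎-dec (rep a ≟ y ×-dec rep b ≟ x)

  InUnion? : ∀ x y → Dec (toℕ x ≤ toℕ y × inUnion H RV RE pair x y ≡ true)
  InUnion? x y = (toℕ x ≤? toℕ y) ×-dec isTrue? (inUnion H RV RE pair x y)

  unionSize≤#ordered : unionSize H RV RE pair ≤ ∑[ a < D ] ∑[ b < D ] 𝟙 (Ordered? a b)
  unionSize≤#ordered = begin
    unionSize H RV RE pair
      ≡⟨ length-filterᵇ-cartesianProduct (λ (x , y) → (toℕ x ℕ.≤ᵇ toℕ y) ∧ inUnion H RV RE pair x y) id id ⟩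
    ∑[ x < D ] ∑[ y < D ] 𝟙 (InUnion? x y)
      ≤⟨ ∑∑𝟙-covering Ordered? InUnion? (λ x y a b → (toℕ x ≤? toℕ y) ×-dec SameEdges? x y a b) covered
                      (λ _ (x≤y , same) (x′≤y′ , same′) → sorted-pair-unique x≤y x′≤y′ same same′) ⟩
    ∑[ a < D ] ∑[ b < D ] 𝟙 (Ordered? a b) ∎
    where
    open ≤-Reasoning
    covered : ∀ {x y} → toℕ x ≤ toℕ y × inUnion H RV RE pair x y ≡ true →
              ∃[ a ] ∃[ b ] (Ordered a b × toℕ x ≤ toℕ y × SameEdges x y a b)
    covered (x≤y , inU) with v , a , b , pv , a↦x , b↦y ← inUnion-witness inU
      with refl ← proj₁ (proj₂ (proj₂ (proj₂ (P.support v a b pv))))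
      with position a ≤? position b
    ... | yes a≤b = a , b , (pv , a≤b) , x≤y , inj₁ (a↦x , b↦y)
    ... | no  a≰b = b , a , (partners-sym pv , <⇒≤ (≰⇒> a≰b)) , x≤y , inj₂ (b↦y , a↦x)

  #ordered≤ : ∑[ a < D ] ∑[ b < D ] 𝟙 (Ordered? a b)
            ≤ (# V=1? + 2 * # V★2?) + (dartsAt V≥3? + (dartsAt V≥3? + 2 * # V★2?))
  #ordered≤ = begin
    ∑[ a < D ] ∑[ b < D ] 𝟙 (Ordered? a b)
      ≡⟨ sum-cong-≗ (λ a → trans (sum-cong-≗ (ordered-split a))
                                  (∑-distrib-+₃ (λ b → 𝟙 (Loop? a b)) (λ b → 𝟙 (Later? a b))
                                                (λ b → 𝟙 (First? a b)))) ⟩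
    ∑[ a < D ] (∑[ b < D ] 𝟙 (Loop? a b) + (∑[ b < D ] 𝟙 (Later? a b) + ∑[ b < D ] 𝟙 (First? a b)))
      ≡⟨ ∑-distrib-+₃ (λ a → ∑[ b < D ] 𝟙 (Loop? a b)) (λ a → ∑[ b < D ] 𝟙 (Later? a b))
                      (λ a → ∑[ b < D ] 𝟙 (First? a b)) ⟩
    ∑[ a < D ] ∑[ b < D ] 𝟙 (Loop? a b)
      + (∑[ a < D ] ∑[ b < D ] 𝟙 (Later? a b) + ∑[ a < D ] ∑[ b < D ] 𝟙 (First? a b))
      ≤⟨ +-mono-≤ (∑-mono-≤ loops-bound)
                  (+-mono-≤ (∑-mono-≤ laters-bound)
                            (≤-trans (≤-reflexive (∑-comm (λ a b → 𝟙 (First? a b)))) (∑-mono-≤ firsts-bound))) ⟩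
    dartsAt (V=1? ∪? V★2?) + (dartsAt V≥3? + dartsAt (V≥3? ∪? V★2?))
      ≤⟨ +-mono-≤ (dartsAt-∪ V=1? V★2?) (+-monoʳ-≤ (dartsAt V≥3?) (dartsAt-∪ V≥3? V★2?)) ⟩
    (dartsAt V=1? + dartsAt V★2?) + (dartsAt V≥3? + (dartsAt V≥3? + dartsAt V★2?))
      ≡⟨ cong₂ (λ l s → (l + s) + (dartsAt V≥3? + (dartsAt V≥3? + s))) dartsAt-V=1 dartsAt-V★2 ⟩
    (# V=1? + 2 * # V★2?) + (dartsAt V≥3? + (dartsAt V≥3? + 2 * # V★2?)) ∎
    where open ≤-Reasoning

pairs-arithmetic : ∀ {L S B k} → S ≤ L + B → B ≤ 3 * L → L ≤ 2 * k → (L + 2 * S) + (B + (B + 2 * S)) ≤ 48 * k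
pairs-arithmetic {L} {S} {B} {k} S≤L+B B≤3L L≤2k = begin
  (L + 2 * S) + (B + (B + 2 * S))                ≤⟨ +-mono-≤ (+-monoʳ-≤ L 2S≤) (+-monoʳ-≤ B (+-monoʳ-≤ B 2S≤)) ⟩
  (L + 2 * (L + B)) + (B + (B + 2 * (L + B)))    ≡⟨ collect L B ⟩
  5 * L + 6 * B                                  ≤⟨ +-monoʳ-≤ (5 * L) (*-monoʳ-≤ 6 B≤3L) ⟩
  5 * L + 6 * (3 * L)                            ≡⟨ collect′ L ⟩
  23 * L                                         ≤⟨ *-monoʳ-≤ 23 L≤2k ⟩
  23 * (2 * k)                                   ≡⟨ *-assoc 23 2 k ⟨
  46 * k                                         ≤⟨ *-monoˡ-≤ k (m≤m+n 46 2) ⟩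
  48 * k                                         ∎
  where
  open ≤-Reasoning
  2S≤ : 2 * S ≤ 2 * (L + B)
  2S≤ = *-monoʳ-≤ 2 S≤L+B
  collect : ∀ L B → (L + 2 * (L + B)) + (B + (B + 2 * (L + B))) ≡ 5 * L + 6 * B
  collect = solve-∀
  collect′ : ∀ L → 5 * L + 6 * (3 * L) ≡ 23 * L
  collect′ = solve-∀

lemma9p3 : (n : ℕ) (adjG : Fin n → Fin n → Bool)
    (H : Map) (Hp : IsPlane H) (ι : Fin n → Fin (Map.N H))
    → IsRadialCompletion H Hp n adjG ι
    → (k : ℕ) (s t : Fin k → Fin n)
    → (∀ i j → s i ≡ s j → i ≡ j)
    → (∀ i j → t i ≡ t j → i ≡ j)
    → (RV : Fin (Map.N H) → Bool) (RE : Fin (Map.D H) → Bool)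
    → IsSubtree H RV RE
    → (∀ v → V=1 H RV RE v ⇔ (∃[ i ] (v ≡ ι (s i) ⊎ v ≡ ι (t i))))
    → (pair : Fin (Map.N H) → Fin (Map.D H) → Fin (Map.D H) → Bool)
    → IsPairing H RV RE pair
    → NonCrossing H RV RE pair
    → unionSize H RV RE pair ≤ 48 * k
lemma9p3 _ _ H _ ι _ k s t _ _ RV RE subtree terminals pair pairing non-crossing = begin
  unionSize H RV RE pair                  ≤⟨ unionSize≤#ordered ⟩
  ∑[ a < D ] ∑[ b < D ] 𝟙 (Ordered? a b)  ≤⟨ #ordered≤ ⟩
  (# V=1? + 2 * # V★2?) + (dartsAt V≥3? + (dartsAt V≥3? + 2 * # V★2?))
    ≤⟨ pairs-arithmetic {k = k} (#V★2≤#V=1+dartsAt-V≥3 subtree) (dartsAt-V≥3≤3*#V=1 subtree)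
                                (#V=1≤2*k ι s t (Equivalence.to (terminals _))) ⟩
  48 * k                                  ∎
  where
  open ≤-Reasoning
  open Map H using (D)
  open Degrees H RV RE
  open PairingCount H RV RE pair pairing non-crossing
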